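{- Let $p_1\neq p_2$ be primes, $\kappa$ an infinite cardinal, $G,H\in K_2(\kappa)$ with $G\leq_{\mathbf{K}_2}H$, and $a\in H\setminus G$. (1) If $p_1^\omega\operatorname{cl}^H_{\mathbf{K}_{TF}}(\{a\}\cup G)\neq p_2^\omega\operatorname{cl}^H_{\mathbf{K}_{TF}}(\{a\}\cup G)$, then $\operatorname{cl}^H_{\mathbf{K}_2}(\{a\}\cup G)=\operatorname{cl}^H_{\mathbf{K}_{TF}}(\{a\}\cup G\cup p_2^\omega H)$. (2) If $p_1^\omega\operatorname{cl}^H_{\mathbf{K}_{TF}}(\{a\}\cup G)=p_2^\omega\operatorname{cl}^H_{\mathbf{K}_{TF}}(\{a\}\cup G)$, then $\operatorname{cl}^H_{\mathbf{K}_2}(\{a\}\cup G)=\operatorname{cl}^H_{\mathbf{K}_{TF}}(\{a\}\cup G)$. In particular, if $a\in p_2^\omega H$, then $\operatorname{cl}^H_{\mathbf{K}_2}(\{a\}\cup G)=\operatorname{cl}^H_{\mathbf{K}_{TF}}(\{a\}\cup G\cup p_2^\omega H)$.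
   Context: For a prime $p$ and group $G$, $p^\omega G:=\bigcap_{n<\omega}p^nG$; $\leq_p$ denotes pure subgroup. $K_2(\kappa)$ is the class of torsion-free abelian $G$ with $|p_1^\omega G|,|p_2^\omega G|\le\kappa$; for $G_1,G_2\in K_2(\kappa)$, $G_1\leq_{\mathbf{K}_2}G_2$ iff $G_1\leq_pG_2$, $p_1^\omega G_1=p_1^\omega G_2$, and either $p_2^\omega G_1=p_1^\omega G_1$ or $p_2^\omega G_1=p_2^\omega G_2$. For $A\subseteq H$: $\operatorname{cl}^H_{\mathbf{K}_2}(A):=\bigcap\{G'\in K_2(\kappa):A\subseteq G'\leq_{\mathbf{K}_2}H\}$ and $\operatorname{cl}^H_{\mathbf{K}_{TF}}(A):=\bigcap\{G'\text{ torsion-free}:A\subseteq G'\leq_pH\}$ (the pure closure of $A$ in $H$). -}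

module Defs where

open import Level using (Level; 0ℓ; _⊔_) renaming (suc to lsuc)
open import Algebra.Bundles using (AbelianGroup)
open import Data.Nat using (ℕ; zero; suc; _^_)
open import Data.Product using (Σ; _×_; ∃-syntax; proj₁)
open import Data.Sum using (_⊎_)
open import Data.Unit using (⊤)
open import Relation.Unary using (Pred; _⊆_; _≐_)
open import Relation.Binary.PropositionalEquality using (_≡_)
open import Relation.Nullary using (¬_)

-- κ is represented by a type K (a cardinal is an isomorphism type of sets).
-- "κ is infinite": ℕ injects into K.
Infinite : Set → Set
Infinite K = Σ (ℕ → K) λ f → ∀ m n → f m ≡ f n → m ≡ n

-- Everything below happens inside a fixed abelian group H (written additively
-- in the paper; the stdlib bundle uses _∙_, ε, _⁻¹, _≈_).  Subgroups of H are
-- predicates on the carrier of H.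
module Over (H : AbelianGroup 0ℓ 0ℓ) where
  open AbelianGroup H

  _·_ : ℕ → Carrier → Carrier
  zero  · x = ε
  suc n · x = x ∙ (n · x)

  TorsionFree : Set
  TorsionFree = ∀ (n : ℕ) (x : Carrier) → ¬ (n ≡ 0) → (n · x) ≈ ε → x ≈ ε

  Full : Pred Carrier 0ℓ
  Full _ = ⊤

  ⟦_⟧ : Carrier → Pred Carrier 0ℓ
  ⟦ a ⟧ x = x ≈ a

  record IsSubgroup {ℓ : Level} (S : Pred Carrier ℓ) : Set ℓ where
    field
      resp  : ∀ {x y} → x ≈ y → S x → S y
      ε∈    : S ε
      ∙∈    : ∀ {x y} → S x → S y → S (x ∙ y)
      ⁻¹∈   : ∀ {x} → S x → S (x ⁻¹)

  -- p^ω S = ⋂_n p^n S, computed inside the group S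
  _^ω_ : {ℓ : Level} → ℕ → Pred Carrier ℓ → Pred Carrier ℓ
  (p ^ω S) x = ∀ (n : ℕ) → ∃[ y ] (S y × ((p ^ n) · y) ≈ x)

  -- S is a pure subgroup of T (S ⊆ T assumed separately): S ∩ nT ⊆ nS
  PureIn : {ℓ₁ ℓ₂ : Level} → Pred Carrier ℓ₁ → Pred Carrier ℓ₂ → Set (ℓ₁ ⊔ ℓ₂)
  PureIn S T = ∀ (n : ℕ) (x : Carrier) → S x →
    ∃[ y ] (T y × (n · y) ≈ x) → ∃[ z ] (S z × (n · z) ≈ x)

  -- |S| ≤ κ : S (modulo ≈) injects into K
  CardLE : {ℓ : Level} → Pred Carrier ℓ → Set → Set ℓ
  CardLE S K = Σ (Σ Carrier S → K) λ f →
    ∀ u v → f u ≡ f v → proj₁ u ≈ proj₁ v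

  -- membership of a subgroup S of H in K₂(κ) (torsion-freeness is inherited
  -- from H, which is assumed torsion-free)
  InK2 : {ℓ : Level} → ℕ → ℕ → Set → Pred Carrier ℓ → Set ℓ
  InK2 p₁ p₂ K S = IsSubgroup S × CardLE (p₁ ^ω S) K × CardLE (p₂ ^ω S) K

  LeK2 : {ℓ₁ ℓ₂ : Level} → ℕ → ℕ → Pred Carrier ℓ₁ → Pred Carrier ℓ₂ → Set (ℓ₁ ⊔ ℓ₂)
  LeK2 p₁ p₂ S T =
    S ⊆ T × PureIn S T × ((p₁ ^ω S) ≐ (p₁ ^ω T)) ×
    (((p₂ ^ω S) ≐ (p₁ ^ω S)) ⊎ ((p₂ ^ω S) ≐ (p₂ ^ω T)))

  clK2 : ℕ → ℕ → Set → Pred Carrier 0ℓ → Pred Carrier (lsuc 0ℓ)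
  clK2 p₁ p₂ K A x = ∀ (G' : Pred Carrier 0ℓ) → InK2 p₁ p₂ K G' → A ⊆ G' →
    LeK2 p₁ p₂ G' Full → G' x

  clTF : Pred Carrier 0ℓ → Pred Carrier (lsuc 0ℓ)
  clTF A x = ∀ (G' : Pred Carrier 0ℓ) → IsSubgroup G' → A ⊆ G' →
    PureIn G' Full → G' x

{-# OPTIONS --safe #-}
-- In a torsion-free group the pure closure of A is {x | n x ∈ ⟨A⟩ for some n ≠ 0}, and for a
-- pure subgroup S one has p^ω S = S ∩ p^ω H.  A pure subgroup S ⊇ G therefore satisfies
-- p₁^ω S = p₁^ω G = p₁^ω H and inherits the cardinality bounds of H, so S ≤_{K₂} H exactly
-- when p₂^ω S = p₁^ω S or p₂^ω S = p₂^ω H.  If the pure closure C of {a} ∪ G satisfies the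
-- first equation, C is the least such S.  Otherwise no S ⊇ C satisfies it (it would pass
-- down to C), so every candidate contains p₂^ω H, and the pure closure of
-- {a} ∪ G ∪ p₂^ω H is the least one.  When a ∈ p₂^ω H ∖ G the first equation fails for C,
-- since a ∈ p₂^ω C while p₁^ω C ⊆ p₁^ω G ⊆ G.
module Submission where

open import Defs
open import Level using (0ℓ; Level)
open import Algebra.Bundles using (AbelianGroup)
open import Data.Nat using (ℕ; zero; suc; _+_; _*_; _^_)
open import Data.Nat.Primality using (Prime)
open import Data.Nat.Properties using (*-comm)
open import Data.Product using (_×_; _,_; proj₁; proj₂; ∃-syntax; map₁; map₂)
open import Data.Sum using (_⊎_; inj₁; inj₂; [_,_])
open import Data.Unit using (tt)
open import Data.Empty using (⊥-elim)
open import Function using (_∘_)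
open import Relation.Unary using (Pred; _∪_; _≐_; _⊆_)
open import Relation.Unary.Properties using (≐-sym; ≐-trans)
open import Relation.Binary.PropositionalEquality using (_≢_)
open import Relation.Nullary using (¬_)

module _ (H : AbelianGroup 0ℓ 0ℓ) where
  open AbelianGroup H
  open Over H
  open import Algebra.Properties.AbelianGroup H using (ε⁻¹≈ε; ⁻¹-∙-comm; x∙y⁻¹≈ε⇒x≈y)
  open import Algebra.Properties.CommutativeMonoid.Mult commutativeMonoid
    using (×-congʳ; ×-congˡ; ×-distrib-+; ×-assocˡ) renaming (_×_ to _×ₘ_)
  open import Relation.Binary.Reasoning.Setoid setoid

  private variable
    ℓ ℓ′ : Level
    x y : Carrier
    A X : Pred Carrier 0ℓ
    S : Pred Carrier ℓ
    T : Pred Carrier ℓ′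

  ·≈×ₘ : ∀ n x → n · x ≈ n ×ₘ x
  ·≈×ₘ zero    x = refl
  ·≈×ₘ (suc n) x = ∙-congˡ (·≈×ₘ n x)

  ×ₘ-inverse : ∀ n x → n ×ₘ (x ⁻¹) ≈ (n ×ₘ x) ⁻¹
  ×ₘ-inverse zero    x = sym ε⁻¹≈ε
  ×ₘ-inverse (suc n) x = trans (∙-congˡ (×ₘ-inverse n x)) (⁻¹-∙-comm x (n ×ₘ x))

  data Generated (A : Pred Carrier 0ℓ) : Pred Carrier 0ℓ where
    gen    : A x → Generated A x
    gen-ε  : Generated A ε
    gen-∙  : Generated A x → Generated A y → Generated A (x ∙ y)
    gen-⁻¹ : Generated A x → Generated A (x ⁻¹)
    gen-≈  : x ≈ y → Generated A x → Generated A y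

  generated-×ₘ : ∀ n → Generated A x → Generated A (n ×ₘ x)
  generated-×ₘ zero    g = gen-ε
  generated-×ₘ (suc n) g = gen-∙ g (generated-×ₘ n g)

  generated-least : IsSubgroup S → A ⊆ S → Generated A ⊆ S
  generated-least S-sub A⊆S (gen a)      = A⊆S a
  generated-least S-sub A⊆S gen-ε        = IsSubgroup.ε∈ S-sub
  generated-least S-sub A⊆S (gen-∙ g h)  =
    IsSubgroup.∙∈ S-sub (generated-least S-sub A⊆S g) (generated-least S-sub A⊆S h)
  generated-least S-sub A⊆S (gen-⁻¹ g)   = IsSubgroup.⁻¹∈ S-sub (generated-least S-sub A⊆S g)
  generated-least S-sub A⊆S (gen-≈ e g)  = IsSubgroup.resp S-sub e (generated-least S-sub A⊆S g)

  -- The multiplier is written suc n, so nonzero multipliers multiply definitionally: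
  -- suc m * suc n reduces to suc (n + m * suc n).
  PureClosure : Pred Carrier 0ℓ → Pred Carrier 0ℓ
  PureClosure A x = ∃[ n ] Generated A (suc n ×ₘ x)

  ⊆-pureClosure : A ⊆ PureClosure A
  ⊆-pureClosure a = 0 , gen-∙ (gen a) gen-ε

  pureClosure-isSubgroup : IsSubgroup (PureClosure A)
  pureClosure-isSubgroup = record
    { resp = λ { e (n , g) → n , gen-≈ (×-congʳ (suc n) e) g }
    ; ε∈   = 0 , gen-∙ gen-ε gen-ε
    ; ∙∈   = λ { (m , g) (n , h) → n + m * suc n , gen-≈ (common-multiple (suc m) (suc n))
                   (gen-∙ (generated-×ₘ (suc n) g) (generated-×ₘ (suc m) h)) }
    ; ⁻¹∈  = λ { {x} (n , g) → n , gen-≈ (sym (×ₘ-inverse (suc n) x)) (gen-⁻¹ g) }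
    }
    where
    common-multiple : ∀ m n {x y} →
      n ×ₘ (m ×ₘ x) ∙ m ×ₘ (n ×ₘ y) ≈ (m * n) ×ₘ (x ∙ y)
    common-multiple m n {x} {y} = begin
      n ×ₘ (m ×ₘ x) ∙ m ×ₘ (n ×ₘ y) ≈⟨ ∙-cong (×-assocˡ x n m) (×-assocˡ y m n) ⟩
      (n * m) ×ₘ x ∙ (m * n) ×ₘ y    ≈⟨ ∙-congʳ (×-congˡ (*-comm n m)) ⟩
      (m * n) ×ₘ x ∙ (m * n) ×ₘ y    ≈⟨ ×-distrib-+ x y (m * n) ⟨
      (m * n) ×ₘ (x ∙ y)             ∎

  pureClosure-pure : PureIn (PureClosure A) Full
  pureClosure-pure zero    x _       (y , _ , 0·y≈x) =
    ε , IsSubgroup.ε∈ pureClosure-isSubgroup , 0·y≈x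
  pureClosure-pure (suc k) x (m , g) (y , _ , k·y≈x) =
    y , (k + m * suc k , gen-≈ multiple-of-y g) , k·y≈x
    where
    multiple-of-y : suc m ×ₘ x ≈ (suc m * suc k) ×ₘ y
    multiple-of-y = begin
      suc m ×ₘ x              ≈⟨ ×-congʳ (suc m) (trans (sym k·y≈x) (·≈×ₘ (suc k) y)) ⟩
      suc m ×ₘ (suc k ×ₘ y)   ≈⟨ ×-assocˡ y (suc m) (suc k) ⟩
      (suc m * suc k) ×ₘ y    ∎

  ⊆-CardLE : {K : Set} → S ⊆ T → CardLE T K → CardLE S K
  ⊆-CardLE S⊆T (f , f-injective) = (λ (x , x∈S) → f (x , S⊆T x∈S)) , λ _ _ → f-injective _ _

  ^ω-mono : ∀ p → S ⊆ T → p ^ω S ⊆ p ^ω T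
  ^ω-mono p S⊆T x∈ n = map₂ (map₁ S⊆T) (x∈ n)

  ^ω⊆^ω-Full : ∀ p → p ^ω S ⊆ p ^ω Full
  ^ω⊆^ω-Full p = ^ω-mono p (λ _ → tt)

  ^ω-cong : ∀ p → S ≐ T → p ^ω S ≐ p ^ω T
  ^ω-cong p (S⊆T , T⊆S) = ^ω-mono p S⊆T , ^ω-mono p T⊆S

  ^ω-⊆ : ∀ p → IsSubgroup S → p ^ω S ⊆ S
  ^ω-⊆ p S-sub x∈ with x∈ 0
  ... | y , y∈S , 1·y≈x = IsSubgroup.resp S-sub (trans (sym (identityʳ y)) 1·y≈x) y∈S

  pure⇒∩^ω⊆^ω : ∀ p → PureIn S Full → S x → (p ^ω Full) x → (p ^ω S) x
  pure⇒∩^ω⊆^ω p S-pure x∈S x∈p^ω n = S-pure (p ^ n) _ x∈S (x∈p^ω n)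

  pure-⊇^ω⇒^ω≐ : ∀ p → PureIn S Full → p ^ω Full ⊆ S → p ^ω S ≐ p ^ω Full
  pure-⊇^ω⇒^ω≐ p S-pure p^ω⊆S = ^ω⊆^ω-Full p , λ x∈ → pure⇒∩^ω⊆^ω p S-pure (p^ω⊆S x∈) x∈

  ^ω≐^ω-resp-≐ : ∀ p q → S ≐ T → p ^ω S ≐ q ^ω S → p ^ω T ≐ q ^ω T
  ^ω≐^ω-resp-≐ p q S≐T balanced =
    ≐-trans (≐-sym (^ω-cong p S≐T)) (≐-trans balanced (^ω-cong q S≐T))

  ^ω≐^ω-descends : ∀ p q → IsSubgroup S → PureIn S Full → S ⊆ T →
    p ^ω Full ⊆ p ^ω T → q ^ω T ≐ p ^ω T → p ^ω S ≐ q ^ω S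
  ^ω≐^ω-descends p q S-sub S-pure S⊆T p^ω⊆ (qT⊆pT , pT⊆qT) =
    (λ x∈ → pure⇒∩^ω⊆^ω q S-pure (^ω-⊆ p S-sub x∈)
              (^ω⊆^ω-Full q (pT⊆qT (p^ω⊆ (^ω⊆^ω-Full p x∈))))) ,
    (λ x∈ → pure⇒∩^ω⊆^ω p S-pure (^ω-⊆ q S-sub x∈)
              (^ω⊆^ω-Full p (qT⊆pT (^ω-mono q S⊆T x∈))))

  module _ (tf : TorsionFree) where

    ×ₘ-cancelˡ : ∀ n → suc n ×ₘ x ≈ suc n ×ₘ y → x ≈ y
    ×ₘ-cancelˡ {x} {y} n e = x∙y⁻¹≈ε⇒x≈y x y (tf (suc n) (x ∙ y ⁻¹) (λ ()) (begin
      suc n · (x ∙ y ⁻¹)               ≈⟨ ·≈×ₘ (suc n) (x ∙ y ⁻¹) ⟩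
      suc n ×ₘ (x ∙ y ⁻¹)              ≈⟨ ×-distrib-+ x (y ⁻¹) (suc n) ⟩
      suc n ×ₘ x ∙ suc n ×ₘ (y ⁻¹)     ≈⟨ ∙-cong e (×ₘ-inverse (suc n) y) ⟩
      suc n ×ₘ y ∙ (suc n ×ₘ y) ⁻¹     ≈⟨ inverseʳ (suc n ×ₘ y) ⟩
      ε                                ∎))

    pure⇒divisionClosed : IsSubgroup S → PureIn S Full → ∀ n → S (suc n · x) → S x
    pure⇒divisionClosed {x = x} S-sub S-pure n n·x∈S
      with S-pure (suc n) (suc n · x) n·x∈S (x , tt , refl)
    ... | z , z∈S , n·z≈n·x = IsSubgroup.resp S-sub (×ₘ-cancelˡ n (begin
      suc n ×ₘ z  ≈⟨ ·≈×ₘ (suc n) z ⟨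
      suc n · z   ≈⟨ n·z≈n·x ⟩
      suc n · x   ≈⟨ ·≈×ₘ (suc n) x ⟩
      suc n ×ₘ x  ∎)) z∈S

    pureClosure-least : IsSubgroup S → A ⊆ S → PureIn S Full → PureClosure A ⊆ S
    pureClosure-least S-sub A⊆S S-pure {x} (n , g) =
      pure⇒divisionClosed S-sub S-pure n
        (IsSubgroup.resp S-sub (sym (·≈×ₘ (suc n) x)) (generated-least S-sub A⊆S g))

    clTF≐pureClosure : ∀ A → clTF A ≐ PureClosure A
    clTF≐pureClosure A =
      (λ x∈ → x∈ (PureClosure A) pureClosure-isSubgroup ⊆-pureClosure pureClosure-pure) ,
      (λ x∈ S S-sub A⊆S S-pure → pureClosure-least S-sub A⊆S S-pure x∈)

    module K₂Closure (p₁ p₂ : ℕ) (K : Set) (H∈K₂ : InK2 p₁ p₂ K Full)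
                     {G : Pred Carrier 0ℓ} (G≤H : LeK2 p₁ p₂ G Full) where

      p₁^ω⊆G : p₁ ^ω Full ⊆ p₁ ^ω G
      p₁^ω⊆G = proj₂ (proj₁ (proj₂ (proj₂ G≤H)))

      clK2-least : InK2 p₁ p₂ K A × LeK2 p₁ p₂ A Full → X ⊆ A → clK2 p₁ p₂ K X ⊆ A
      clK2-least {A = A} (A∈K₂ , A≤H) X⊆A x∈ = x∈ A A∈K₂ X⊆A A≤H

      clTF⊆clK2 : ∀ X → clTF X ⊆ clK2 p₁ p₂ K X
      clTF⊆clK2 X x∈ S (S-sub , _) X⊆S (_ , S-pure , _) = x∈ S S-sub X⊆S S-pure

      pure-⊇G⇒≤K₂ : IsSubgroup S → PureIn S Full → G ⊆ S →
        (p₂ ^ω S ≐ p₁ ^ω S) ⊎ (p₂ ^ω S ≐ p₂ ^ω Full) → InK2 p₁ p₂ K S × LeK2 p₁ p₂ S Full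
      pure-⊇G⇒≤K₂ S-sub S-pure G⊆S alternative =
        (S-sub , ⊆-CardLE (^ω⊆^ω-Full p₁) H-card₁ , ⊆-CardLE (^ω⊆^ω-Full p₂) H-card₂) ,
        (λ _ → tt) , S-pure , (^ω⊆^ω-Full p₁ , ^ω-mono p₁ G⊆S ∘ p₁^ω⊆G) , alternative
        where
        H-card₁ : CardLE (p₁ ^ω Full) K
        H-card₁ = proj₁ (proj₂ H∈K₂)
        H-card₂ : CardLE (p₂ ^ω Full) K
        H-card₂ = proj₂ (proj₂ H∈K₂)

      clK2≐clTF : G ⊆ X → p₁ ^ω clTF X ≐ p₂ ^ω clTF X → clK2 p₁ p₂ K X ≐ clTF X
      clK2≐clTF {X} G⊆X balanced =
        proj₂ (clTF≐pureClosure X) ∘ clK2-least closure-≤K₂ ⊆-pureClosure , clTF⊆clK2 X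
        where
        closure-≤K₂ : InK2 p₁ p₂ K (PureClosure X) × LeK2 p₁ p₂ (PureClosure X) Full
        closure-≤K₂ = pure-⊇G⇒≤K₂ pureClosure-isSubgroup pureClosure-pure (⊆-pureClosure ∘ G⊆X)
          (inj₁ (≐-sym (^ω≐^ω-resp-≐ p₁ p₂ (clTF≐pureClosure X) balanced)))

      clK2≐clTF-∪p₂^ω : G ⊆ X → ¬ (p₁ ^ω clTF X ≐ p₂ ^ω clTF X) →
        clK2 p₁ p₂ K X ≐ clTF (X ∪ p₂ ^ω Full)
      clK2≐clTF-∪p₂^ω {X} G⊆X unbalanced =
        proj₂ (clTF≐pureClosure Y) ∘ clK2-least closure-≤K₂ (⊆-pureClosure ∘ inj₁) ,
        λ x∈ S S∈K₂ X⊆S S≤H →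
          x∈ S (proj₁ S∈K₂) [ X⊆S , p₂^ω⊆ S S∈K₂ X⊆S S≤H ] (proj₁ (proj₂ S≤H))
        where
        Y : Pred Carrier 0ℓ
        Y = X ∪ p₂ ^ω Full
        closure-≤K₂ : InK2 p₁ p₂ K (PureClosure Y) × LeK2 p₁ p₂ (PureClosure Y) Full
        closure-≤K₂ = pure-⊇G⇒≤K₂ pureClosure-isSubgroup pureClosure-pure
          (⊆-pureClosure ∘ inj₁ ∘ G⊆X)
          (inj₂ (pure-⊇^ω⇒^ω≐ p₂ pureClosure-pure (⊆-pureClosure ∘ inj₂)))
        -- A candidate S with p₂^ω S = p₁^ω S would pass that equation down to the pure closure of X.
        p₂^ω⊆ : ∀ S → InK2 p₁ p₂ K S → X ⊆ S → LeK2 p₁ p₂ S Full → p₂ ^ω Full ⊆ S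
        p₂^ω⊆ S (S-sub , _) X⊆S (_ , S-pure , S-p₁ , inj₁ balanced) = ⊥-elim (unbalanced
          (^ω≐^ω-resp-≐ p₁ p₂ (≐-sym (clTF≐pureClosure X))
            (^ω≐^ω-descends p₁ p₂ pureClosure-isSubgroup pureClosure-pure
              (pureClosure-least S-sub X⊆S S-pure) (proj₂ S-p₁) balanced)))
        p₂^ω⊆ S (S-sub , _) _ (_ , _ , _ , inj₂ S-p₂) = ^ω-⊆ p₂ S-sub ∘ proj₂ S-p₂

      p₂^ω∖G⇒unbalanced : IsSubgroup G → X x → (p₂ ^ω Full) x → ¬ G x →
        ¬ (p₁ ^ω clTF X ≐ p₂ ^ω clTF X)
      p₂^ω∖G⇒unbalanced {X} G-sub x∈X x∈p₂^ω x∉G balanced = x∉G (^ω-⊆ p₁ G-sub (p₁^ω⊆G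
        (^ω⊆^ω-Full p₁ (proj₂ closure-balanced
          (pure⇒∩^ω⊆^ω p₂ pureClosure-pure (⊆-pureClosure x∈X) x∈p₂^ω)))))
        where
        closure-balanced : p₁ ^ω PureClosure X ≐ p₂ ^ω PureClosure X
        closure-balanced = ^ω≐^ω-resp-≐ p₁ p₂ (clTF≐pureClosure X) balanced

proposition4p6 : (p₁ p₂ : ℕ) → Prime p₁ → Prime p₂ → p₁ ≢ p₂ →
    (K : Set) → Infinite K →
    (H : AbelianGroup 0ℓ 0ℓ) →
    let open AbelianGroup H using (Carrier)
        open Over H
    in TorsionFree → InK2 p₁ p₂ K Full →
    (G : Pred Carrier 0ℓ) → InK2 p₁ p₂ K G → LeK2 p₁ p₂ G Full →
    (a : Carrier) → ¬ G a →
    ((¬ ((p₁ ^ω clTF (⟦ a ⟧ ∪ G)) ≐ (p₂ ^ω clTF (⟦ a ⟧ ∪ G))) →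
        clK2 p₁ p₂ K (⟦ a ⟧ ∪ G) ≐ clTF ((⟦ a ⟧ ∪ G) ∪ (p₂ ^ω Full)))
     × (((p₁ ^ω clTF (⟦ a ⟧ ∪ G)) ≐ (p₂ ^ω clTF (⟦ a ⟧ ∪ G))) →
        clK2 p₁ p₂ K (⟦ a ⟧ ∪ G) ≐ clTF (⟦ a ⟧ ∪ G))
     × ((p₂ ^ω Full) a →
        clK2 p₁ p₂ K (⟦ a ⟧ ∪ G) ≐ clTF ((⟦ a ⟧ ∪ G) ∪ (p₂ ^ω Full))))
proposition4p6 p₁ p₂ _ _ _ K _ H tf H∈K₂ G (G-sub , _) G≤H a a∉G =
    clK2≐clTF-∪p₂^ω inj₂
  , clK2≐clTF inj₂
  , λ a∈p₂^ω → clK2≐clTF-∪p₂^ω inj₂ (p₂^ω∖G⇒unbalanced G-sub (inj₁ refl) a∈p₂^ω a∉G)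
  where
  open AbelianGroup H using (refl)
  open K₂Closure H tf p₁ p₂ K H∈K₂ G≤H
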